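{- For every type $\sigma$ and terms $t,s$: if $t\in[\![\sigma]\!]$ and $s\in[\![\mathtt{list}\,\sigma]\!]$, then $t::s\in[\![\mathtt{list}\,\sigma]\!]$.
   Context: Calculus $\lambda^{::}_{\mathtt{catch}}$. Types: $\sigma,\tau,\rho ::= \mathtt{unit} \mid \mathtt{list}\,\tau \mid \sigma\to\tau$. Terms: $t,r,s ::= x \mid () \mid \mathtt{nil} \mid (::) \mid \mathtt{lrec} \mid \lambda x.r \mid t\,s \mid \mathtt{catch}\,\alpha\,t \mid \mathtt{throw}\,\alpha\,t$ ($x$ variables, $\alpha,\beta$ continuation variables; application left-associative; $t::r$ abbreviates $(::)\,t\,r$). $\mathrm{FCV}$ = free continuation variables, $t[x:=r]$ capture-avoiding substitution. Values: $v,w ::= x \mid () \mid \mathtt{nil} \mid (::) \mid (::)\,v \mid (::)\,v\,w \mid \mathtt{lrec} \mid \mathtt{lrec}\,v \mid \mathtt{lrec}\,v\,w \mid \lambda x.r$. Contexts $E ::= \Box\,t \mid v\,\Box \mid \mathtt{throw}\,\alpha\,\Box$. Reduction $\to$ is the compatible closure of: $(\lambda x.t)\,v\to t[x:=v]$; $E[\mathtt{throw}\,\alpha\,t]\to\mathtt{throw}\,\alpha\,t$; $\mathtt{catch}\,\alpha\,(\mathtt{throw}\,\alpha\,t)\to\mathtt{catch}\,\alpha\,t$; $\mathtt{catch}\,\alpha\,(\mathtt{throw}\,\beta\,v)\to\mathtt{throw}\,\beta\,v$ if $\alpha\notin\{\beta\}\cup\mathrm{FCV}(v)$; $\mathtt{catch}\,\alpha\,v\to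 v$ if $\alpha\notin\mathrm{FCV}(v)$; $\mathtt{lrec}\,v_r\,v_s\,\mathtt{nil}\to v_r$; $\mathtt{lrec}\,v_r\,v_s\,(v_h::v_t)\to v_s\,v_h\,v_t\,(\mathtt{lrec}\,v_r\,v_s\,v_t)$; $\twoheadrightarrow$ is its reflexive-transitive closure. $\mathrm{SN}$ is the set of terms $t$ for which the lengths of all reduction sequences starting at $t$ are bounded. For a set of terms $S$, $L(S)$ is inductively defined by: $t\in L(S)$ if for all values $v,w$ with $t\twoheadrightarrow v::w$ we have $v\in S$ and $w\in L(S)$. Interpretation: $[\![\mathtt{unit}]\!]=\mathrm{SN}$, $[\![\mathtt{list}\,\sigma]\!]=\mathrm{SN}\cap L([\![\sigma]\!])$, $[\![\sigma\to\tau]\!]=\{t\mid \forall s\in[\![\sigma]\!],\ ts\in[\![\tau]\!]\}$. -}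

module Defs where

open import Data.Nat using (ℕ; zero; suc; pred; _<ᵇ_; _≡ᵇ_)
open import Data.Bool using (Bool; true; false; if_then_else_)
open import Data.Product using (_×_; ∃)
open import Data.Sum using (_⊎_)
open import Data.Empty using (⊥)
open import Relation.Nullary using (¬_)
open import Relation.Binary.PropositionalEquality using (_≡_)

data Ty : Set where
  unitTy : Ty
  listTy : Ty → Ty
  _⇒_    : Ty → Ty → Ty

-- Term variables and continuation variables live in separate
-- de Bruijn index spaces; `lam` binds term variable 0, `catch`
-- binds continuation variable 0.

data Tm : Set where
  var   : ℕ → Tm
  ⟨⟩    : Tm
  nil   : Tm
  cons  : Tm
  lrec  : Tm
  lam   : Tm → Tm
  _·_   : Tm → Tm → Tm
  catch : Tm → Tm
  throw : ℕ → Tm → Tm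

infixl 7 _·_

_∷ₜ_ : Tm → Tm → Tm
t ∷ₜ r = (cons · t) · r

shiftT : ℕ → Tm → Tm
shiftT c (var x)     = if x <ᵇ c then var x else var (suc x)
shiftT c ⟨⟩          = ⟨⟩
shiftT c nil         = nil
shiftT c cons        = cons
shiftT c lrec        = lrec
shiftT c (lam r)     = lam (shiftT (suc c) r)
shiftT c (t · s)     = shiftT c t · shiftT c s
shiftT c (catch t)   = catch (shiftT c t)
shiftT c (throw α t) = throw α (shiftT c t)

shiftC : ℕ → Tm → Tm
shiftC c (var x)     = var x
shiftC c ⟨⟩          = ⟨⟩
shiftC c nil         = nil
shiftC c cons        = cons
shiftC c lrec        = lrec
shiftC c (lam r)     = lam (shiftC c r)
shiftC c (t · s)     = shiftC c t · shiftC c s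
shiftC c (catch t)   = catch (shiftC (suc c) t)
shiftC c (throw α t) = throw (if α <ᵇ c then α else suc α) (shiftC c t)

-- lower continuation variables > c by one (used when c is not free)
lowerC : ℕ → Tm → Tm
lowerC c (var x)     = var x
lowerC c ⟨⟩          = ⟨⟩
lowerC c nil         = nil
lowerC c cons        = cons
lowerC c lrec        = lrec
lowerC c (lam r)     = lam (lowerC c r)
lowerC c (t · s)     = lowerC c t · lowerC c s
lowerC c (catch t)   = catch (lowerC (suc c) t)
lowerC c (throw α t) = throw (if α <ᵇ c then α else pred α) (lowerC c t)

subst : ℕ → Tm → Tm → Tm
subst k v (var x)     = if x ≡ᵇ k then v else (if x <ᵇ k then var x else var (pred x))
subst k v ⟨⟩          = ⟨⟩
subst k v nil         = nil
subst k v cons        = cons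
subst k v lrec        = lrec
subst k v (lam r)     = lam (subst (suc k) (shiftT 0 v) r)
subst k v (t · s)     = subst k v t · subst k v s
subst k v (catch t)   = catch (subst k (shiftC 0 v) t)
subst k v (throw α t) = throw α (subst k v t)

FreeC : ℕ → Tm → Set
FreeC α (var x)     = ⊥
FreeC α ⟨⟩          = ⊥
FreeC α nil         = ⊥
FreeC α cons        = ⊥
FreeC α lrec        = ⊥
FreeC α (lam r)     = FreeC α r
FreeC α (t · s)     = FreeC α t ⊎ FreeC α s
FreeC α (catch t)   = FreeC (suc α) t
FreeC α (throw β t) = (α ≡ β) ⊎ FreeC α t

data Value : Tm → Set where
  v-var   : ∀ x → Value (var x)
  v-unit  : Value ⟨⟩
  v-nil   : Value nil
  v-cons0 : Value cons
  v-cons1 : ∀ {v} → Value v → Value (cons · v)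
  v-cons2 : ∀ {v w} → Value v → Value w → Value ((cons · v) · w)
  v-lrec0 : Value lrec
  v-lrec1 : ∀ {v} → Value v → Value (lrec · v)
  v-lrec2 : ∀ {v w} → Value v → Value w → Value ((lrec · v) · w)
  v-lam   : ∀ r → Value (lam r)

infix 4 _⟶_ _↠_

data _⟶_ : Tm → Tm → Set where
  β-lam     : ∀ {t v} → Value v → (lam t · v) ⟶ subst 0 v t
  thr-appL  : ∀ {α t s} → (throw α t · s) ⟶ throw α t
  thr-appR  : ∀ {α t v} → Value v → (v · throw α t) ⟶ throw α t
  thr-thr   : ∀ {α β t} → throw β (throw α t) ⟶ throw α t
  catch-thr : ∀ {t} → catch (throw 0 t) ⟶ catch t
  -- catch α (throw β v) → throw β v   if α ∉ {β} ∪ FCV(v)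
  catch-esc : ∀ {β v} → Value v → ¬ FreeC 0 v →
              catch (throw (suc β) v) ⟶ throw β (lowerC 0 v)
  catch-val : ∀ {v} → Value v → ¬ FreeC 0 v → catch v ⟶ lowerC 0 v
  lrec-nil  : ∀ {vr vs} → Value vr → Value vs → ((lrec · vr) · vs) · nil ⟶ vr
  lrec-cons : ∀ {vr vs vh vt} → Value vr → Value vs → Value vh → Value vt →
              ((lrec · vr) · vs) · (vh ∷ₜ vt) ⟶ ((vs · vh) · vt) · (((lrec · vr) · vs) · vt)
  ξ-appL    : ∀ {t t' s} → t ⟶ t' → t · s ⟶ t' · s
  ξ-appR    : ∀ {t s s'} → s ⟶ s' → t · s ⟶ t · s'
  ξ-lam     : ∀ {r r'} → r ⟶ r' → lam r ⟶ lam r'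
  ξ-catch   : ∀ {t t'} → t ⟶ t' → catch t ⟶ catch t'
  ξ-throw   : ∀ {α t t'} → t ⟶ t' → throw α t ⟶ throw α t'

data _↠_ : Tm → Tm → Set where
  ↠-refl : ∀ {t} → t ↠ t
  ↠-step : ∀ {t t' t''} → t ⟶ t' → t' ↠ t'' → t ↠ t''

BoundedBy : ℕ → Tm → Set
BoundedBy zero    t = ∀ t' → ¬ (t ⟶ t')
BoundedBy (suc n) t = ∀ t' → t ⟶ t' → BoundedBy n t'

SN : Tm → Set
SN t = ∃ λ n → BoundedBy n t

data L (S : Tm → Set) : Tm → Set where
  mkL : ∀ {t} →
        (∀ v w → Value v → Value w → t ↠ (v ∷ₜ w) → S v × L S w) →
        L S t

⟦_⟧ : Ty → Tm → Set
⟦ unitTy ⟧   t = SN t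
⟦ listTy σ ⟧ t = SN t × L ⟦ σ ⟧ t
⟦ σ ⇒ τ ⟧    t = ∀ s → ⟦ σ ⟧ s → ⟦ τ ⟧ (t · s)

-- The reducts of t :: s are of two kinds only: t' :: s' with t ↠ t' and s ↠ s', or
-- applications headed by a throw (and those never become a cons again).  Hence the
-- list part of the claim follows from closure of ⟦ σ ⟧ and L under reduction.  For
-- strong normalisation, t :: s is the head cons applied to strongly normalising
-- arguments; no redex can fire at such a head, so reduction only consumes the
-- arguments' bounds, while a throw reaching the head just keeps the bound of the
-- argument it came from.  That t itself is strongly normalising is the usual
-- reducibility fact ⟦ σ ⟧ ⊆ SN, proved simultaneously with the fact that variables
-- applied to strongly normalising arguments inhabit every ⟦ σ ⟧.
module Submission where

open import Defs
open import Data.Nat using (ℕ; zero; suc; _+_; _≤_; _<_; s≤s)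
open import Data.Nat.Properties using (≤-refl; ≤-trans; ≤-pred; m≤m+n; m≤n+m; n<1+n; +-monoʳ-<; +-monoˡ-≤)
open import Data.Product using (_×_; _,_; ∃; proj₁; proj₂)
open import Data.Sum using (_⊎_; inj₁; inj₂)
open import Data.Empty using (⊥-elim)
open import Relation.Nullary using (¬_)
open import Relation.Binary.PropositionalEquality using (_≡_; refl)

private
  variable
    α k m n : ℕ
    h s t t' u v w : Tm
    S : Tm → Set

↠-trans : t ↠ u → u ↠ v → t ↠ v
↠-trans ↠-refl q = q
↠-trans (↠-step r p) q = ↠-step r (↠-trans p q)

↠-appˡ : t ↠ t' → t · s ↠ t' · s
↠-appˡ ↠-refl = ↠-refl
↠-appˡ (↠-step r rs) = ↠-step (ξ-appL r) (↠-appˡ rs)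

BoundedBy-appˡ : BoundedBy n (t · s) → BoundedBy n t
BoundedBy-appˡ {zero} b _ r = b _ (ξ-appL r)
BoundedBy-appˡ {suc n} b _ r = BoundedBy-appˡ (b _ (ξ-appL r))

SN-⟶ : SN t → t ⟶ t' → SN t'
SN-⟶ (zero , b) r = ⊥-elim (b _ r)
SN-⟶ (suc n , b) r = n , b _ r

SN-↠ : SN t → t ↠ t' → SN t'
SN-↠ h ↠-refl = h
SN-↠ h (↠-step r rs) = SN-↠ (SN-⟶ h r) rs

L-↠ : L S t → t ↠ t' → L S t'
L-↠ (mkL f) rs = mkL λ v w vv vw rs' → f v w vv vw (↠-trans rs rs')

Decreasing : (ℕ → Tm → Set) → Set
Decreasing P = ∀ {m t t'} → P m t → t ⟶ t' → ∃ λ m' → m' < m × P m' t'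

module _ {P : ℕ → Tm → Set} (dec : Decreasing P) where

  decreasing⇒BoundedBy : P m t → BoundedBy m t
  decreasing⇒BoundedBy = bounded ≤-refl
    where
    bounded : m ≤ n → P m t → BoundedBy n t
    bounded {n = zero} m≤0 p _ r with dec p r
    ... | _ , m'<m , _ with ≤-trans m'<m m≤0
    ... | ()
    bounded {n = suc n} m≤1+n p _ r with dec p r
    ... | _ , m'<m , p' = bounded (≤-pred (≤-trans m'<m m≤1+n)) p'

  decreasing⇒SN : P m t → SN t
  decreasing⇒SN p = _ , decreasing⇒BoundedBy p

  decreasing-↠ : P m t → t ↠ u → ∃ λ m' → P m' u
  decreasing-↠ p ↠-refl = _ , p
  decreasing-↠ p (↠-step r rs) = decreasing-↠ (proj₂ (proj₂ (dec p r))) rs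

-- Heads at which no redex can be formed by application.
data Head : Tm → Set where
  var  : ∀ x → Head (var x)
  cons : Head cons

-- Spine h n t: t is h or a throw, applied to strongly normalising arguments, and n
-- is the sum of the bounds of those arguments plus one per application.
data Spine (h : Tm) : ℕ → Tm → Set where
  head  : Head h → Spine h 0 h
  throw : BoundedBy n (throw α t) → Spine h n (throw α t)
  _·_   : Spine h m t → BoundedBy k s → Spine h (suc (m + k)) (t · s)

Spine-decreasing : Decreasing (Spine h)
Spine-decreasing (head ()) (β-lam _)
Spine-decreasing (throw {zero} b) r = ⊥-elim (b _ r)
Spine-decreasing (throw {suc n} b) r@thr-thr = n , ≤-refl , throw (b _ r)
Spine-decreasing (throw {suc n} b) r@(ξ-throw _) = n , ≤-refl , throw (b _ r)
Spine-decreasing (head () · _) (β-lam _)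
Spine-decreasing (_·_ {m} {k = k} (throw b) _) thr-appL = m , s≤s (m≤m+n m k) , throw b
Spine-decreasing (_·_ {m} {k = k} _ b) (thr-appR _) = k , s≤s (m≤n+m k m) , throw b
Spine-decreasing (((head () · _) · _) · _) (lrec-nil _ _)
Spine-decreasing (((head () · _) · _) · _) (lrec-cons _ _ _ _)
Spine-decreasing (_·_ {k = k} p b) (ξ-appL r) with Spine-decreasing p r
... | m' , m'<m , p' = suc (m' + k) , s≤s (+-monoˡ-≤ k m'<m) , p' · b
Spine-decreasing (_·_ {k = zero} p b) (ξ-appR r) = ⊥-elim (b _ r)
Spine-decreasing (_·_ {m} {k = suc k} p b) (ξ-appR r) =
  suc (m + k) , s≤s (+-monoʳ-< m (n<1+n k)) , p · b _ r

var-Spine-≢-∷ : ∀ {x} → ¬ Spine (var x) n (v ∷ₜ w)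
var-Spine-≢-∷ (() · _ · _)

mutual
  ⟦⟧⇒SN : ∀ σ → ⟦ σ ⟧ t → SN t
  ⟦⟧⇒SN unitTy h = h
  ⟦⟧⇒SN (listTy σ) h = proj₁ h
  ⟦⟧⇒SN (σ ⇒ τ) h with ⟦⟧⇒SN τ (h (var 0) (var-Spine⇒⟦⟧ σ (head (var 0))))
  ... | n , b = n , BoundedBy-appˡ b

  var-Spine⇒⟦⟧ : ∀ σ {x} → Spine (var x) n t → ⟦ σ ⟧ t
  var-Spine⇒⟦⟧ unitTy p = decreasing⇒SN Spine-decreasing p
  var-Spine⇒⟦⟧ (listTy σ) p =
    decreasing⇒SN Spine-decreasing p ,
    mkL λ _ _ _ _ rs → ⊥-elim (var-Spine-≢-∷ (proj₂ (decreasing-↠ Spine-decreasing p rs)))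
  var-Spine⇒⟦⟧ (σ ⇒ τ) p s hs = var-Spine⇒⟦⟧ τ (p · proj₂ (⟦⟧⇒SN σ hs))

⟦⟧-↠ : ∀ σ → ⟦ σ ⟧ t → t ↠ t' → ⟦ σ ⟧ t'
⟦⟧-↠ unitTy h rs = SN-↠ h rs
⟦⟧-↠ (listTy σ) (hSN , hL) rs = SN-↠ hSN rs , L-↠ hL rs
⟦⟧-↠ (σ ⇒ τ) h rs s hs = ⟦⟧-↠ τ (h s hs) (↠-appˡ rs)

data ThrowHeaded : Tm → Set where
  throw : ThrowHeaded (throw α t)
  _·_   : ThrowHeaded t → ∀ s → ThrowHeaded (t · s)

ThrowHeaded-⟶ : ThrowHeaded t → t ⟶ u → ThrowHeaded u
ThrowHeaded-⟶ throw thr-thr = throw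
ThrowHeaded-⟶ throw (ξ-throw _) = throw
ThrowHeaded-⟶ (() · _) (β-lam _)
ThrowHeaded-⟶ (_ · _) thr-appL = throw
ThrowHeaded-⟶ (_ · _) (thr-appR _) = throw
ThrowHeaded-⟶ (((() · _) · _) · _) (lrec-nil _ _)
ThrowHeaded-⟶ (((() · _) · _) · _) (lrec-cons _ _ _ _)
ThrowHeaded-⟶ (p · s) (ξ-appL r) = ThrowHeaded-⟶ p r · s
ThrowHeaded-⟶ (p · s) (ξ-appR r) = p · _

ThrowHeaded-↠ : ThrowHeaded t → t ↠ u → ThrowHeaded u
ThrowHeaded-↠ p ↠-refl = p
ThrowHeaded-↠ p (↠-step r rs) = ThrowHeaded-↠ (ThrowHeaded-⟶ p r) rs

∷-reduct : t ∷ₜ s ↠ u →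
  (∃ λ t' → ∃ λ s' → u ≡ t' ∷ₜ s' × t ↠ t' × s ↠ s') ⊎ ThrowHeaded u
∷-reduct ↠-refl = inj₁ (_ , _ , refl , ↠-refl , ↠-refl)
∷-reduct (↠-step (thr-appR _) rs) = inj₂ (ThrowHeaded-↠ throw rs)
∷-reduct (↠-step (ξ-appL (thr-appR _)) rs) = inj₂ (ThrowHeaded-↠ (throw · _) rs)
∷-reduct (↠-step (ξ-appL (ξ-appL ())) rs)
∷-reduct (↠-step (ξ-appL (ξ-appR r)) rs) with ∷-reduct rs
... | inj₁ (t' , s' , eq , p , q) = inj₁ (t' , s' , eq , ↠-step r p , q)
... | inj₂ p = inj₂ p
∷-reduct (↠-step (ξ-appR r) rs) with ∷-reduct rs
... | inj₁ (t' , s' , eq , p , q) = inj₁ (t' , s' , eq , p , ↠-step r q)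
... | inj₂ p = inj₂ p

∷-↠-∷ : t ∷ₜ s ↠ v ∷ₜ w → t ↠ v × s ↠ w
∷-↠-∷ rs with ∷-reduct rs
... | inj₁ (_ , _ , refl , p , q) = p , q
... | inj₂ ((() · _) · _)

SN-∷ : SN t → SN s → SN (t ∷ₜ s)
SN-∷ (_ , bt) (_ , bs) = decreasing⇒SN Spine-decreasing ((head cons · bt) · bs)

lemma4p14 : (σ : Ty) (t s : Tm) → ⟦ σ ⟧ t → ⟦ listTy σ ⟧ s → ⟦ listTy σ ⟧ (t ∷ₜ s)
lemma4p14 σ t s ht (hsSN , hsL) =
  SN-∷ (⟦⟧⇒SN σ ht) hsSN ,
  mkL λ _ _ _ _ rs → let t↠v , s↠w = ∷-↠-∷ rs
                     in ⟦⟧-↠ σ ht t↠v , L-↠ hsL s↠w
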